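{- Let $BS(1,3)=\langle a,b\mid ab=ba^3\rangle$ and $BS^{+}(1,3)=\{b^m a^x: m\in\mathbb{Z}_{\ge 0}, x\in\mathbb{Z}\}$. Let $S\subseteq BS^{+}(1,3)$ be a finite non-abelian set of size $k\geq 2$. Suppose $S=\{s_0,s_1,\dots,s_t\}$ with $s_i=b^{m_i}a^{x_i}$ for $1\le i\le t$, $s_0=a^{x_0}$, where $x_i\in\mathbb{Z}$ and $0=m_0<m_1<\cdots<m_t$ are integers (so each coset $b^{m_i}a^{\mathbb{Z}}$ contains exactly one element of $S$). If the subgroup generated by $T=S\setminus\{s_0\}$ is abelian, then $|S^2|\geq 4k-4$, where $S^2=\{st:s,t\in S\}$.
   Context: In $BS(1,3)$ one has $(b^m a^x)(b^n a^y)=b^{m+n}a^{3^n x+y}$ for $m,n\ge 0$. A set is called non-abelian if the subgroup it generates is non-abelian. -}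

module Defs where

open import Data.Nat as ℕ using (ℕ; zero; suc)
import Data.Nat.Properties as ℕP
open import Data.Integer as ℤ using (ℤ; +_; -[1+_])
import Data.Integer.Properties as ℤP
open import Data.Rational as ℚ using (ℚ)
import Data.Rational.Properties as ℚP
open import Data.Product using (_×_; _,_; ∃; ∃-syntax)
open import Data.Product.Properties using (≡-dec)
open import Data.Fin using (Fin)
open import Data.List using (List; length; deduplicate; allFin; map; concatMap)
open import Relation.Binary.PropositionalEquality using (_≡_)
open import Relation.Binary.Definitions using (DecidableEquality)
open import Relation.Nullary using (¬_)

-- Model of BS(1,3) = < a, b | ab = ba^3 > as (a subgroup of) the semidirect
-- product ℤ ⋉ ℚ : the pair (m , x) stands for b^m a^x, with
--   (m , x)(n , y) = (m + n , 3^n x + y).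
-- a = (0 , 1), b = (1 , 0); indeed ab = (1 , 3) = ba^3.  The actual BS(1,3)
-- is the subgroup generated by a and b (second coordinates in ℤ[1/3]);
-- subgroups generated by subsets of it are the same computed here.

pow3 : ℤ → ℚ
pow3 (+ n) = (+ (3 ℕ.^ n)) ℚ./ 1
pow3 -[1+ n ] = (+ 1) ℚ./ (3 ℕ.^ suc n)
  where instance _ = ℕP.m^n≢0 3 (suc n)

G : Set
G = ℤ × ℚ

_·_ : G → G → G
(m , x) · (n , y) = (m ℤ.+ n , (pow3 n ℚ.* x) ℚ.+ y)

e : G
e = (+ 0 , ℚ.0ℚ)

inv : G → G
inv (m , x) = (ℤ.- m , ℚ.- (pow3 (ℤ.- m) ℚ.* x))

_≟G_ : DecidableEquality G
_≟G_ = ≡-dec ℤ._≟_ ℚP._≟_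

ι : ℕ × ℤ → G
ι (m , x) = (+ m , x ℚ./ 1)

data ⟨_⟩ (P : G → Set) : G → Set where
  gen : ∀ {g} → P g → ⟨ P ⟩ g
  one : ⟨ P ⟩ e
  mul : ∀ {g h} → ⟨ P ⟩ g → ⟨ P ⟩ h → ⟨ P ⟩ (g · h)
  inverse : ∀ {g} → ⟨ P ⟩ g → ⟨ P ⟩ (inv g)

AbelianGen : (G → Set) → Set
AbelianGen P = ∀ {g h} → ⟨ P ⟩ g → ⟨ P ⟩ h → g · h ≡ h · g

NonAbelian : (G → Set) → Set
NonAbelian P = ¬ AbelianGen P

setOf : ∀ {n} → (Fin n → ℕ) → (Fin n → ℤ) → G → Set
setOf {n} m x g = ∃[ i ] ι (m i , x i) ≡ g

setOfTail : ∀ {t} → (Fin (suc t) → ℕ) → (Fin (suc t) → ℤ) → G → Set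
setOfTail {t} m x g = ∃[ i ] ι (m (Fin.suc i) , x (Fin.suc i)) ≡ g
  where import Data.Fin as Fin

sqCard : ∀ {n} → (Fin n → ℕ) → (Fin n → ℤ) → ℕ
sqCard {n} m x =
  length (deduplicate _≟G_
    (concatMap (λ i → map (λ j → ι (m i , x i) · ι (m j , x j)) (allFin n)) (allFin n)))

{-# OPTIONS --safe #-}
-- Write s₀ = a^x₀ and T = {s₁, …, s_t}; then x₀ ≠ 0, since otherwise ⟨S⟩ = ⟨T⟩ is abelian.
-- The 4t products
--   s₀s₀;   s₁s₁, s₁s₂, s₂s₂, …, s_ts_t;   s₀s_j and s_js₀ (1 ≤ j ≤ t)
-- are pairwise distinct.  The height (exponent of b) separates s₀s₀, the only one of height 0, and
-- strictly increases along the staircase s_is_i, s_is_{i+1}.  The staircase lies in the abelian group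
-- ⟨T⟩, hence in the centraliser of s₁, which contains at most one element of each height because
-- 3^{m₁} ≠ 1; at height m_j this is s_j.  So s₀s_j and s_js₀, which differ from s_j as x₀ ≠ 0, lie
-- outside it, and s₀s_j = s_ks₀ would force j = k and make a^x₀ commute with s_j.
module Submission where

open import Defs
open import Data.Nat using (ℕ; zero; suc; _*_; _∸_; _≤_; _<_)
open import Data.Integer using (ℤ)
open import Data.Fin using (Fin)
open import Relation.Binary.PropositionalEquality using (_≡_)

open import Data.Nat using (_+_; _^_; z≤n; s≤s; z<s; s<s)
import Data.Nat.Properties as ℕP
import Data.Nat.Tactic.RingSolver as ℕ-Solver
open import Data.Integer as ℤ using (+_; 0ℤ; 1ℤ)
import Data.Integer.Properties as ℤP
open import Data.Integer.GCD using (gcd-zeroʳ)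
open import Data.Integer.Tactic.RingSolver using (solve-∀)
open import Algebra.Properties.AbelianGroup ℤP.+-0-abelianGroup
  using () renaming (∙-cancelˡ to ℤ-+-cancelˡ; ∙-cancelʳ to ℤ-+-cancelʳ)
import Data.Rational as ℚ
import Data.Rational.Properties as ℚP
open import Data.Rational.Unnormalised as ℚᵘ using (mkℚᵘ; *≡*)
import Data.Rational.Unnormalised.Properties as ℚᵘP
open import Data.Fin as Fin using ()
open import Data.Product using (_×_; _,_; proj₁; proj₂; ∃₂)
open import Data.Sum using (inj₁; inj₂)
open import Data.List using (List; []; _∷_; [_]; _++_; map; length; tabulate; allFin; concatMap;
  deduplicate; cartesianProductWith)
open import Data.List.Properties using (length-++; length-map; length-tabulate; length-removeAt′)
open import Data.List.Membership.Propositional using (_∈_; _─_)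
open import Data.List.Membership.Propositional.Properties using (∈-map⁺; ∈-map⁻; ∈-++⁻; ∈-allFin;
  ∈-tabulate⁻; ∈-concat⁺′; ∈-deduplicate⁺; ∈-cartesianProductWith⁺; ∈-cartesianProductWith⁻)
open import Data.List.Relation.Binary.Subset.Propositional using (_⊆_)
open import Data.List.Relation.Binary.Disjoint.Propositional using (Disjoint)
open import Data.List.Relation.Unary.Any using (here; there)
import Data.List.Relation.Unary.All as All
open import Data.List.Relation.Unary.AllPairs as AllPairs using ([]; _∷_)
open import Data.List.Relation.Unary.Linked using (Linked; []; [-]; _∷_)
open import Data.List.Relation.Unary.Linked.Properties using (Linked⇒AllPairs)
open import Data.List.Relation.Unary.Unique.Propositional using (Unique)
import Data.List.Relation.Unary.Unique.Propositional.Properties as Unique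
open import Function using (_∘_; _on_)
open import Relation.Binary.Core using (Rel)
open import Relation.Nullary using (¬_; yes; no; contradiction)
open import Relation.Binary.PropositionalEquality
  using (_≢_; refl; sym; trans; cong; cong₂; subst; module ≡-Reasoning)

∈-─⁺ : ∀ {A : Set} {x z : A} {ys} (x∈ys : x ∈ ys) → z ∈ ys → z ≢ x → z ∈ ys ─ x∈ys
∈-─⁺ (here refl) (here refl)  z≢x = contradiction refl z≢x
∈-─⁺ (here refl) (there z∈ys) _   = z∈ys
∈-─⁺ (there _)   (here refl)  _   = here refl
∈-─⁺ (there x∈)  (there z∈)   z≢x = there (∈-─⁺ x∈ z∈ z≢x)

Unique-⊆⇒length≤ : ∀ {A : Set} {xs ys : List A} → Unique xs → xs ⊆ ys → length xs ≤ length ys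
Unique-⊆⇒length≤ [] _ = z≤n
Unique-⊆⇒length≤ {xs = x ∷ _} {ys} (x∉xs ∷ xs!) x∷xs⊆ys =
  subst (_ ≤_) (sym (length-removeAt′ ys _))
    (s≤s (Unique-⊆⇒length≤ xs! λ z∈xs →
      ∈-─⁺ x∈ys (x∷xs⊆ys (there z∈xs)) (λ z≡x → All.lookup x∉xs z∈xs (sym z≡x))))
  where
  x∈ys : x ∈ ys
  x∈ys = x∷xs⊆ys (here refl)

ascending⇒Unique : ∀ {A : Set} (f : A → ℕ) {xs} → Linked (_<_ on f) xs → Unique xs
ascending⇒Unique f ↑ =
  AllPairs.map (λ fx<fy x≡y → ℕP.<-irrefl (cong f x≡y) fx<fy) (Linked⇒AllPairs ℕP.<-trans ↑)

Linked-tabulate⁺ : ∀ {a ℓ} {A : Set a} {R : Rel A ℓ} {n} (f : Fin n → A) →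
                  (∀ {i j} → i Fin.< j → R (f i) (f j)) → Linked R (tabulate f)
Linked-tabulate⁺ {n = zero}        f mono = []
Linked-tabulate⁺ {n = suc zero}    f mono = [-]
Linked-tabulate⁺ {n = suc (suc n)} f mono = mono z<s ∷ Linked-tabulate⁺ (f ∘ Fin.suc) (mono ∘ s<s)

toℚᵘ-/1 : ∀ i → ℚ.toℚᵘ (i ℚ./ 1) ℚᵘ.≃ mkℚᵘ i 0
toℚᵘ-/1 i = ℚP.toℚᵘ-fromℚᵘ (mkℚᵘ i 0)

/1-homo : ∀ a x y → (a ℚ./ 1) ℚ.* (x ℚ./ 1) ℚ.+ (y ℚ./ 1) ≡ (a ℤ.* x ℤ.+ y) ℚ./ 1
/1-homo a x y = ℚP.toℚᵘ-injective (begin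
  toℚᵘ ((a / 1) ℚ.* (x / 1) ℚ.+ (y / 1))
    ≈⟨ ℚP.toℚᵘ-homo-+ ((a / 1) ℚ.* (x / 1)) (y / 1) ⟩
  toℚᵘ ((a / 1) ℚ.* (x / 1)) ℚᵘ.+ toℚᵘ (y / 1)
    ≈⟨ ℚᵘP.+-cong (ℚᵘP.≃-trans (ℚP.toℚᵘ-homo-* (a / 1) (x / 1)) (ℚᵘP.*-cong (toℚᵘ-/1 a) (toℚᵘ-/1 x))) (toℚᵘ-/1 y) ⟩
  mkℚᵘ a 0 ℚᵘ.* mkℚᵘ x 0 ℚᵘ.+ mkℚᵘ y 0
    ≈⟨ *≡* (cross-multiplied a x y) ⟩
  mkℚᵘ (a ℤ.* x ℤ.+ y) 0
    ≈⟨ ℚᵘP.≃-sym (toℚᵘ-/1 _) ⟩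
  toℚᵘ ((a ℤ.* x ℤ.+ y) / 1) ∎)
  where
  open ℚᵘP.≃-Reasoning
  open ℚ using (_/_; toℚᵘ)
  cross-multiplied : ∀ a x y → ((a ℤ.* x) ℤ.* + 1 ℤ.+ y ℤ.* + 1) ℤ.* + 1 ≡ (a ℤ.* x ℤ.+ y) ℤ.* + 1
  cross-multiplied = solve-∀

/1-injective : ∀ {i j} → i ℚ./ 1 ≡ j ℚ./ 1 → i ≡ j
/1-injective {i} {j} i/1≡j/1 = trans (sym (↥-/1 i)) (trans (cong ℚ.↥_ i/1≡j/1) (↥-/1 j))
  where
  ↥-/1 : ∀ i → ℚ.↥ (i ℚ./ 1) ≡ i
  ↥-/1 i = trans (sym (ℤP.*-identityʳ _))
             (trans (cong (ℚ.↥ (i ℚ./ 1) ℤ.*_) (sym (gcd-zeroʳ i))) (ℚP.↥-/ i 1))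

i*j≡j⇒j≡0 : ∀ {i j} → i ≢ 1ℤ → i ℤ.* j ≡ j → j ≡ 0ℤ
i*j≡j⇒j≡0 {i} {j} i≢1 ij≡j with j ℤ.≟ 0ℤ
... | yes j≡0 = j≡0
... | no j≢0 = contradiction
  (ℤP.*-cancelʳ-≡ i 1ℤ j {{ℤ.≢-nonZero j≢0}} (trans ij≡j (sym (ℤP.*-identityˡ j)))) i≢1

3^[1+n]≢1 : ∀ n → + (3 ^ suc n) ≢ 1ℤ
3^[1+n]≢1 n 3^[1+n]≡1 with ℕP.m^n≡1⇒n≡0∨m≡1 3 (suc n) (ℤP.+-injective 3^[1+n]≡1)
... | inj₁ ()
... | inj₂ ()

BS⁺ : Set
BS⁺ = ℕ × ℤ

height : BS⁺ → ℕ
height = proj₁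

infixl 7 _⋆_
_⋆_ : BS⁺ → BS⁺ → BS⁺
(m , x) ⋆ (n , y) = (m + n , + (3 ^ n) ℤ.* x ℤ.+ y)

ε : BS⁺
ε = (0 , 0ℤ)

Commute : BS⁺ → BS⁺ → Set
Commute p q = p ⋆ q ≡ q ⋆ p

ι-homo : ∀ p q → ι p · ι q ≡ ι (p ⋆ q)
ι-homo (m , x) (n , y) = cong (+ (m + n) ,_) (/1-homo (+ (3 ^ n)) x y)

ι-injective : ∀ {p q} → ι p ≡ ι q → p ≡ q
ι-injective ιp≡ιq = cong₂ _,_ (ℤP.+-injective (cong proj₁ ιp≡ιq)) (/1-injective (cong proj₂ ιp≡ιq))

⋆-identityˡ : ∀ p → ε ⋆ p ≡ p
⋆-identityˡ (n , y) = cong (n ,_) (trans (cong (ℤ._+ y) (ℤP.*-zeroʳ (+ (3 ^ n)))) (ℤP.+-identityˡ y))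

⋆-identityʳ : ∀ p → p ⋆ ε ≡ p
⋆-identityʳ (m , x) = cong₂ _,_ (ℕP.+-identityʳ m) (trans (ℤP.+-identityʳ _) (ℤP.*-identityˡ x))

commute-ε : ∀ p → Commute p ε
commute-ε p = trans (⋆-identityʳ p) (sym (⋆-identityˡ p))

⋆-cancelˡ : ∀ {p q r} → p ⋆ q ≡ p ⋆ r → q ≡ r
⋆-cancelˡ {M , X} {m , x} {n , y} pq≡pr with ℕP.+-cancelˡ-≡ M m n (cong proj₁ pq≡pr)
... | refl = cong (m ,_) (ℤ-+-cancelˡ (+ (3 ^ m) ℤ.* X) x y (cong proj₂ pq≡pr))

⋆-cancelʳ : ∀ {p q r} → q ⋆ p ≡ r ⋆ p → q ≡ r
⋆-cancelʳ {M , X} {m , x} {n , y} qp≡rp =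
  cong₂ _,_ (ℕP.+-cancelʳ-≡ M m n (cong proj₁ qp≡rp))
            (ℤP.*-cancelˡ-≡ (+ (3 ^ M)) x y {{ℕP.m^n≢0 3 M}}
              (ℤ-+-cancelʳ X (+ (3 ^ M) ℤ.* x) (+ (3 ^ M) ℤ.* y) (cong proj₂ qp≡rp)))

-- Commuting with c = b^k a^z means 3^k y + z = 3^M z + y for p = b^M a^y; as 3^k ≠ 1 this fixes y.
centraliser-height-injective : ∀ {c p q} → 1 ≤ height c → Commute c p → Commute c q →
                               height p ≡ height q → p ≡ q
centraliser-height-injective {suc k , z} {M , y} {.M , y′} _ cp cq refl =
  cong (M ,_) (ℤP.i-j≡0⇒i≡j y y′ (i*j≡j⇒j≡0 (3^[1+n]≢1 k) (begin
    a ℤ.* (y ℤ.- y′)                       ≡⟨ expand a y y′ z ⟩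
    (a ℤ.* y ℤ.+ z) ℤ.- (a ℤ.* y′ ℤ.+ z)   ≡⟨ cong₂ ℤ._-_ (sym (cong proj₂ cp)) (sym (cong proj₂ cq)) ⟩
    (b ℤ.* z ℤ.+ y) ℤ.- (b ℤ.* z ℤ.+ y′)   ≡⟨ cancel b z y y′ ⟩
    y ℤ.- y′                                ∎)))
  where
  open ≡-Reasoning
  a b : ℤ
  a = + (3 ^ suc k)
  b = + (3 ^ M)
  expand : ∀ a y y′ z → a ℤ.* (y ℤ.- y′) ≡ (a ℤ.* y ℤ.+ z) ℤ.- (a ℤ.* y′ ℤ.+ z)
  expand = solve-∀
  cancel : ∀ b z y y′ → (b ℤ.* z ℤ.+ y) ℤ.- (b ℤ.* z ℤ.+ y′) ≡ y ℤ.- y′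
  cancel = solve-∀

square : List BS⁺ → List BS⁺
square ps = cartesianProductWith _⋆_ ps ps

∈-square⁺ : ∀ ps {p q} → p ∈ ps → q ∈ ps → p ⋆ q ∈ square ps
∈-square⁺ ps {p} {q} = ∈-cartesianProductWith⁺ _⋆_ {a = p} {b = q}

∈-square⁻ : ∀ ps {z} → z ∈ square ps → ∃₂ λ p q → p ∈ ps × q ∈ ps × z ≡ p ⋆ q
∈-square⁻ ps = ∈-cartesianProductWith⁻ _⋆_ ps ps

square-mono : ∀ {ps qs} → ps ⊆ qs → square ps ⊆ square qs
square-mono {ps} ps⊆qs z∈ with ∈-square⁻ ps z∈
... | p , q , p∈ , q∈ , refl = ∈-square⁺ _ (ps⊆qs p∈) (ps⊆qs q∈)

staircase : BS⁺ → List BS⁺ → List BS⁺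
staircase p []       = [ p ⋆ p ]
staircase p (q ∷ qs) = p ⋆ p ∷ p ⋆ q ∷ staircase q qs

length-staircase : ∀ p qs → length (staircase p qs) ≡ suc (length qs + length qs)
length-staircase p []       = refl
length-staircase p (q ∷ qs) =
  cong (suc ∘ suc) (trans (length-staircase q qs) (sym (ℕP.+-suc (length qs) (length qs))))

staircase⊆square : ∀ p qs → staircase p qs ⊆ square (p ∷ qs)
staircase⊆square p []       (here refl)        = ∈-square⁺ [ p ] (here refl) (here refl)
staircase⊆square p (q ∷ qs) (here refl)        = ∈-square⁺ (p ∷ q ∷ qs) (here refl) (here refl)
staircase⊆square p (q ∷ qs) (there (here refl)) =
  ∈-square⁺ (p ∷ q ∷ qs) (here refl) (there (here refl))
staircase⊆square p (q ∷ qs) (there (there z∈)) = square-mono there (staircase⊆square q qs z∈)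

staircase-ascending : ∀ {p qs} → Linked (_<_ on height) (p ∷ qs) → Linked (_<_ on height) (staircase p qs)
staircase-ascending [-] = [-]
staircase-ascending {p} {q ∷ _} (p<q ∷ [-]) =
  ℕP.+-monoʳ-< (height p) p<q ∷ ℕP.+-monoˡ-< (height q) p<q ∷ [-]
staircase-ascending {p} {q ∷ _} (p<q ∷ q↑@(_ ∷ _)) =
  ℕP.+-monoʳ-< (height p) p<q ∷ ℕP.+-monoˡ-< (height q) p<q ∷ staircase-ascending q↑

-- Z stands for the abelian group ⟨T⟩, pulled back along ι.
module DistinctProducts
  (Z : BS⁺ → Set)
  (Z-⋆ : ∀ {p q} → Z p → Z q → Z (p ⋆ q))
  (Z-commute : ∀ {p q} → Z p → Z q → Commute p q)
  (s₀ c : BS⁺) (ts : List BS⁺)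
  (height-s₀ : height s₀ ≡ 0)
  (s₀≢ε : s₀ ≢ ε)
  (1≤height-c : 1 ≤ height c)
  (ascending : Linked (_<_ on height) (c ∷ ts))
  (T⊆Z : ∀ {p} → p ∈ c ∷ ts → Z p)
  where

  T : List BS⁺
  T = c ∷ ts

  left right : List BS⁺
  left  = map (s₀ ⋆_) T
  right = map (_⋆ s₀) T

  products : List BS⁺
  products = s₀ ⋆ s₀ ∷ staircase c ts ++ left ++ right

  T-positive : ∀ {p} → p ∈ T → 1 ≤ height p
  T-positive (here refl) = 1≤height-c
  T-positive (there p∈ts) with Linked⇒AllPairs ℕP.<-trans ascending
  ... | c<ts ∷ _ = ℕP.≤-trans 1≤height-c (ℕP.<⇒≤ (All.lookup c<ts p∈ts))

  height-s₀⋆ : ∀ p → height (s₀ ⋆ p) ≡ height p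
  height-s₀⋆ p = cong (_+ height p) height-s₀

  height-⋆s₀ : ∀ p → height (p ⋆ s₀) ≡ height p
  height-⋆s₀ p = trans (cong (λ k → height p + k) height-s₀) (ℕP.+-identityʳ (height p))

  central-unique : ∀ {p z} → p ∈ T → Commute c z → height z ≡ height p → z ≡ p
  central-unique p∈ cz = centraliser-height-injective 1≤height-c cz (Z-commute (T⊆Z (here refl)) (T⊆Z p∈))

  staircase-central : ∀ {z} → z ∈ staircase c ts → Commute c z
  staircase-central z∈ with ∈-square⁻ T (staircase⊆square c ts z∈)
  ... | p , q , p∈ , q∈ , refl = Z-commute (T⊆Z (here refl)) (Z-⋆ (T⊆Z p∈) (T⊆Z q∈))

  sides-noncentral : ∀ {z} → z ∈ left ++ right → ¬ Commute c z
  sides-noncentral z∈ with ∈-++⁻ left z∈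
  ... | inj₁ z∈left with ∈-map⁻ _ z∈left
  ...   | p , p∈ , refl = λ cz → s₀≢ε (⋆-cancelʳ
          (trans (central-unique p∈ cz (height-s₀⋆ p)) (sym (⋆-identityˡ p))))
  sides-noncentral z∈ | inj₂ z∈right with ∈-map⁻ _ z∈right
  ...   | p , p∈ , refl = λ cz → s₀≢ε (⋆-cancelˡ
          (trans (central-unique p∈ cz (height-⋆s₀ p)) (sym (⋆-identityʳ p))))

  -- s₀ p = q s₀ forces p = q (both are central of equal height), and then s₀ = ε commutes with p.
  left#right : Disjoint left right
  left#right (z∈left , z∈right) with ∈-map⁻ _ z∈left | ∈-map⁻ _ z∈right
  ... | p , p∈ , refl | q , q∈ , s₀p≡qs₀
    with central-unique q∈ (Z-commute (T⊆Z (here refl)) (T⊆Z p∈))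
           (trans (sym (height-s₀⋆ p)) (trans (cong height s₀p≡qs₀) (height-⋆s₀ q)))
  ... | refl = s₀≢ε (centraliser-height-injective (T-positive p∈) (sym s₀p≡qs₀) (commute-ε p) height-s₀)

  rest-positive : ∀ {z} → z ∈ staircase c ts ++ left ++ right → 1 ≤ height z
  rest-positive z∈ with ∈-++⁻ (staircase c ts) z∈
  ... | inj₁ z∈stair with ∈-square⁻ T (staircase⊆square c ts z∈stair)
  ...   | p , _ , p∈ , _ , refl = ℕP.≤-trans (T-positive p∈) (ℕP.m≤m+n _ _)
  rest-positive z∈ | inj₂ z∈sides with ∈-++⁻ left z∈sides
  ... | inj₁ z∈left with ∈-map⁻ _ z∈left
  ...   | p , p∈ , refl = subst (1 ≤_) (sym (height-s₀⋆ p)) (T-positive p∈)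
  rest-positive z∈ | inj₂ z∈sides | inj₂ z∈right with ∈-map⁻ _ z∈right
  ...   | p , p∈ , refl = subst (1 ≤_) (sym (height-⋆s₀ p)) (T-positive p∈)

  products-unique : Unique products
  products-unique =
    All.tabulate (λ z∈ s₀s₀≡z → ℕP.<⇒≢ (rest-positive z∈) (sym (height-s₀s₀ s₀s₀≡z)))
    ∷ Unique.++⁺ (ascending⇒Unique height (staircase-ascending ascending))
        (Unique.++⁺ (Unique.map⁺ ⋆-cancelˡ T-unique) (Unique.map⁺ ⋆-cancelʳ T-unique) left#right)
        (λ (z∈stair , z∈sides) → sides-noncentral z∈sides (staircase-central z∈stair))
    where
    T-unique : Unique T
    T-unique = ascending⇒Unique height ascending
    height-s₀s₀ : ∀ {z} → s₀ ⋆ s₀ ≡ z → height z ≡ 0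
    height-s₀s₀ refl = trans (height-s₀⋆ s₀) height-s₀

  length-products : length products ≡ 4 * length T
  length-products = begin
    suc (length (staircase c ts ++ left ++ right))
      ≡⟨ cong suc (trans (length-++ (staircase c ts))
                         (cong (λ k → length (staircase c ts) + k) (length-++ left))) ⟩
    suc (length (staircase c ts) + (length left + length right))
      ≡⟨ cong suc (cong₂ _+_ (length-staircase c ts) (cong₂ _+_ (length-map _ T) (length-map _ T))) ⟩
    suc (suc (n + n) + (suc n + suc n))
      ≡⟨ count n ⟩
    4 * suc n ∎
    where
    open ≡-Reasoning
    n : ℕ
    n = length ts
    count : ∀ n → suc (suc (n + n) + (suc n + suc n)) ≡ 4 * suc n
    count = ℕ-Solver.solve-∀

  products⊆square : products ⊆ square (s₀ ∷ T)
  products⊆square (here refl) = ∈-square⁺ (s₀ ∷ T) (here refl) (here refl)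
  products⊆square (there z∈) with ∈-++⁻ (staircase c ts) z∈
  ... | inj₁ z∈stair = square-mono there (staircase⊆square c ts z∈stair)
  ... | inj₂ z∈sides with ∈-++⁻ left z∈sides
  ...   | inj₁ z∈left with ∈-map⁻ _ z∈left
  ...     | p , p∈ , refl = ∈-square⁺ (s₀ ∷ T) (here refl) (there p∈)
  products⊆square (there z∈) | inj₂ z∈sides | inj₂ z∈right with ∈-map⁻ _ z∈right
  ...     | p , p∈ , refl = ∈-square⁺ (s₀ ∷ T) (there p∈) (here refl)

module _ {t} (m : Fin (suc t) → ℕ) (x : Fin (suc t) → ℤ) where

  s : Fin (suc t) → BS⁺
  s i = (m i , x i)

  squareList : List G
  squareList = concatMap (λ i → map (λ j → ι (s i) · ι (s j)) (allFin (suc t))) (allFin (suc t))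

  ι-square⊆squareList : ∀ {z} → z ∈ square (tabulate s) → ι z ∈ squareList
  ι-square⊆squareList z∈ with ∈-square⁻ (tabulate s) z∈
  ... | p , q , p∈ , q∈ , refl with ∈-tabulate⁻ {f = s} p∈ | ∈-tabulate⁻ {f = s} q∈
  ... | i , refl | j , refl = subst (_∈ squareList) (ι-homo (s i) (s j))
    (∈-concat⁺′ (∈-map⁺ (λ j → ι (s i) · ι (s j)) (∈-allFin j))
                (∈-map⁺ (λ i → map (λ j → ι (s i) · ι (s j)) (allFin (suc t))) (∈-allFin i)))

  sqCard-≥ : ∀ {zs} → Unique zs → zs ⊆ square (tabulate s) → length zs ≤ sqCard m x
  sqCard-≥ {zs} zs! zs⊆ = subst (_≤ sqCard m x) (length-map ι zs)
    (Unique-⊆⇒length≤ (Unique.map⁺ ι-injective zs!) ιzs⊆)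
    where
    ιzs⊆ : map ι zs ⊆ deduplicate _≟G_ squareList
    ιzs⊆ g∈ with ∈-map⁻ ι g∈
    ... | z , z∈ , refl = ∈-deduplicate⁺ _≟G_ (ι-square⊆squareList (zs⊆ z∈))

  InTail : BS⁺ → Set
  InTail p = ⟨ setOfTail m x ⟩ (ι p)

  InTail-⋆ : ∀ {p q} → InTail p → InTail q → InTail (p ⋆ q)
  InTail-⋆ {p} {q} gp gq = subst ⟨ setOfTail m x ⟩ (ι-homo p q) (mul gp gq)

  InTail-commute : AbelianGen (setOfTail m x) → ∀ {p q} → InTail p → InTail q → Commute p q
  InTail-commute abelian {p} {q} gp gq =
    ι-injective (trans (sym (ι-homo p q)) (trans (abelian gp gq) (ι-homo q p)))

  tail⊆InTail : ∀ {p} → p ∈ tabulate (s ∘ Fin.suc) → InTail p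
  tail⊆InTail p∈ with ∈-tabulate⁻ {f = s ∘ Fin.suc} p∈
  ... | i , refl = gen (i , refl)

  ⟨S⟩⊆⟨T⟩ : s Fin.zero ≡ ε → ∀ {g} → ⟨ setOf m x ⟩ g → ⟨ setOfTail m x ⟩ g
  ⟨S⟩⊆⟨T⟩ s₀≡ε (gen (Fin.zero , refl)) = subst ⟨ setOfTail m x ⟩ (sym (cong ι s₀≡ε)) one
  ⟨S⟩⊆⟨T⟩ s₀≡ε (gen (Fin.suc i , ιsᵢ≡g)) = gen (i , ιsᵢ≡g)
  ⟨S⟩⊆⟨T⟩ s₀≡ε one = one
  ⟨S⟩⊆⟨T⟩ s₀≡ε (mul g h) = mul (⟨S⟩⊆⟨T⟩ s₀≡ε g) (⟨S⟩⊆⟨T⟩ s₀≡ε h)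
  ⟨S⟩⊆⟨T⟩ s₀≡ε (inverse g) = inverse (⟨S⟩⊆⟨T⟩ s₀≡ε g)

lemma2p3 : (t : ℕ) → 1 ≤ t → (m : Fin (suc t) → ℕ) → (x : Fin (suc t) → ℤ)
    → m Fin.zero ≡ 0
    → (∀ (i j : Fin (suc t)) → i Data.Fin.< j → m i < m j)
    → NonAbelian (setOf m x)
    → AbelianGen (setOfTail m x)
    → 4 * suc t ∸ 4 ≤ sqCard m x
lemma2p3 (suc u) _ m x m₀≡0 mono nonAbelian abelianT = begin
  4 * suc (suc u) ∸ 4       ≡⟨ trans (cong (_∸ 4) (ℕP.*-suc 4 (suc u))) (ℕP.m+n∸m≡n 4 _) ⟩
  4 * suc u                 ≡⟨ cong (λ k → 4 * suc k) (sym (length-tabulate _)) ⟩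
  4 * length T              ≡⟨ sym length-products ⟩
  length products           ≤⟨ sqCard-≥ m x products-unique products⊆square ⟩
  sqCard m x                ∎
  where
  open ℕP.≤-Reasoning
  s₀≢ε : s m x Fin.zero ≢ ε
  s₀≢ε s₀≡ε = nonAbelian λ g h → abelianT (⟨S⟩⊆⟨T⟩ m x s₀≡ε g) (⟨S⟩⊆⟨T⟩ m x s₀≡ε h)
  open DistinctProducts (InTail m x) (InTail-⋆ m x) (InTail-commute m x abelianT)
    (s m x Fin.zero) (s m x (Fin.suc Fin.zero)) (tabulate (s m x ∘ Fin.suc ∘ Fin.suc))
    m₀≡0 s₀≢ε (subst (_< m (Fin.suc Fin.zero)) m₀≡0 (mono _ _ z<s))
    (Linked-tabulate⁺ (s m x ∘ Fin.suc) (mono _ _ ∘ s<s)) (tail⊆InTail m x)
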